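{- \textsc{Maximum Minimal $st$-Separator} is CMSO-definable with a formula of length $\mathcal{O}(k)$: for every positive integer $k$ there is a CMSO formula $\psi_k$ (over the graph vocabulary, with $s,t$ as distinguished vertices) of length $\mathcal{O}(k)$ such that for every graph $G$ and distinct $s,t\in V(G)$, $G\models\psi_k$ if and only if $G$ has a minimal $st$-separator of size at least $k$.
   Context: All graphs are finite, simple and undirected. An $st$-separator is a set $Z\subseteq V(G)\setminus\{s,t\}$ such that $G-Z$ has no $s$–$t$ path; it is minimal if no proper subset is an $st$-separator. CMSO is Counting Monadic Second Order logic on graphs (quantification over vertices and vertex sets, the adjacency relation, and modular counting predicates). -}

module Defs where

open import Data.Nat using (ℕ; zero; suc; _+_; _*_; _≤_)
open import Data.Nat.DivMod using (_%_)
open import Data.Fin using (Fin; zero; suc)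
open import Data.Fin.Subset using (Subset; _∈_; _∉_; _⊂_; ∣_∣)
open import Data.Bool using (Bool; true; false)
open import Data.Vec using (Vec; []; _∷_; lookup)
open import Data.Product using (Σ; _×_; _,_)
open import Data.Sum using (_⊎_)
open import Data.Empty using (⊥)
open import Relation.Nullary using (¬_)
open import Relation.Binary.PropositionalEquality using (_≡_)

record Graph : Set where
  field
    n     : ℕ
    E     : Fin n → Fin n → Bool
    sym   : ∀ u v → E u v ≡ E v u
    irrefl : ∀ v → E v v ≡ false

open Graph public

Adj : (G : Graph) → Fin (n G) → Fin (n G) → Set
Adj G u v = E G u v ≡ true

data Reach (G : Graph) (Z : Subset (n G)) : Fin (n G) → Fin (n G) → Set where
  here : ∀ {u} → u ∉ Z → Reach G Z u u
  step : ∀ {u w v} → u ∉ Z → Adj G u w → Reach G Z w v → Reach G Z u v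

IsSeparator : (G : Graph) → Fin (n G) → Fin (n G) → Subset (n G) → Set
IsSeparator G s t Z = s ∉ Z × t ∉ Z × ¬ Reach G Z s t

IsMinimalSeparator : (G : Graph) → Fin (n G) → Fin (n G) → Subset (n G) → Set
IsMinimalSeparator G s t Z =
  IsSeparator G s t Z × (∀ Z′ → Z′ ⊂ Z → ¬ IsSeparator G s t Z′)

HasMinSepAtLeast : (G : Graph) → Fin (n G) → Fin (n G) → ℕ → Set
HasMinSepAtLeast G s t k =
  Σ (Subset (n G)) λ Z → IsMinimalSeparator G s t Z × k ≤ ∣ Z ∣

-- CMSO over the graph vocabulary.
-- Formula v S : v free vertex (first-order) variables, S free set
-- (monadic second-order) variables, as de Bruijn indices.

data Formula : ℕ → ℕ → Set where
  adj  : ∀ {v S} → Fin v → Fin v → Formula v S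
  eq   : ∀ {v S} → Fin v → Fin v → Formula v S
  mem  : ∀ {v S} → Fin v → Fin S → Formula v S
  -- modular counting: |X| ≡ a (mod m+1)
  cnt  : ∀ {v S} → (a m : ℕ) → Fin S → Formula v S
  ¬′   : ∀ {v S} → Formula v S → Formula v S
  _∧′_ : ∀ {v S} → Formula v S → Formula v S → Formula v S
  _∨′_ : ∀ {v S} → Formula v S → Formula v S → Formula v S
  ∃v   : ∀ {v S} → Formula (suc v) S → Formula v S
  ∀v   : ∀ {v S} → Formula (suc v) S → Formula v S
  ∃S   : ∀ {v S} → Formula v (suc S) → Formula v S
  ∀S   : ∀ {v S} → Formula v (suc S) → Formula v S

length : ∀ {v S} → Formula v S → ℕ
length (adj _ _)   = 1
length (eq _ _)    = 1
length (mem _ _)   = 1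
length (cnt _ _ _) = 1
length (¬′ φ)      = suc (length φ)
length (φ ∧′ ψ)    = suc (length φ + length ψ)
length (φ ∨′ ψ)    = suc (length φ + length ψ)
length (∃v φ)      = suc (length φ)
length (∀v φ)      = suc (length φ)
length (∃S φ)      = suc (length φ)
length (∀S φ)      = suc (length φ)

Sat : (G : Graph) → ∀ {v S} → Vec (Fin (n G)) v → Vec (Subset (n G)) S → Formula v S → Set
Sat G ρ σ (adj i j)   = Adj G (lookup ρ i) (lookup ρ j)
Sat G ρ σ (eq i j)    = lookup ρ i ≡ lookup ρ j
Sat G ρ σ (mem i X)   = lookup ρ i ∈ lookup σ X
Sat G ρ σ (cnt a m X) = ∣ lookup σ X ∣ % suc m ≡ a % suc m
Sat G ρ σ (¬′ φ)      = ¬ Sat G ρ σ φ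
Sat G ρ σ (φ ∧′ ψ)    = Sat G ρ σ φ × Sat G ρ σ ψ
Sat G ρ σ (φ ∨′ ψ)    = Sat G ρ σ φ ⊎ Sat G ρ σ ψ
Sat G ρ σ (∃v φ)      = Σ (Fin (n G)) λ x → Sat G (x ∷ ρ) σ φ
Sat G ρ σ (∀v φ)      = (x : Fin (n G)) → Sat G (x ∷ ρ) σ φ
Sat G ρ σ (∃S φ)      = Σ (Subset (n G)) λ X → Sat G ρ (X ∷ σ) φ
Sat G ρ σ (∀S φ)      = (X : Subset (n G)) → Sat G ρ (X ∷ σ) φ

-- G with distinguished vertices s, t satisfies a sentence over {s,t}
-- (free vertex variable 0 = s, 1 = t)
_,_,_⊨_ : (G : Graph) → Fin (n G) → Fin (n G) → Formula 2 0 → Set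
G , s , t ⊨ φ = Sat G (s ∷ t ∷ []) [] φ

{-# OPTIONS --safe #-}
module Submission where

-- Z separates s from t exactly when some set R ∋ s, R ∌ t is closed under
-- the edges of G - Z: a closed set contains every vertex reachable from s,
-- and conversely the set of vertices reachable from s is closed (obtained by
-- adding endpoints of leaving edges until none is left).  Closedness and
-- proper inclusion are first-order over set variables, so minimality is one
-- more universal set quantifier.  The bound ∣Z∣ ≥ k needs no k vertex
-- quantifiers: it holds iff some Y ⊆ Z has ∣Y∣ ≡ k (mod k + 1), a single
-- counting atom, so ψ k even has length independent of k.

open import Defs
open import Data.Nat using (ℕ; zero; suc; _+_; _*_; _≤_; _<_; z≤n; s≤s)
open import Data.Nat.Properties
  using (≤-trans; ≤-reflexive; <-≤-trans; <-irrefl; +-suc; +-monoʳ-≤; m≤m+n; m≤m*n; n<1+n; module ≤-Reasoning)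
open import Data.Nat.DivMod using (_%_; m%n≤m; m<n⇒m%n≡m)
open import Data.Fin using (Fin; zero; suc)
open import Data.Fin.Properties using (any?)
open import Data.Fin.Subset using (Subset; _∈_; _∉_; _⊆_; _⊂_; ∣_∣; _∪_; ⁅_⁆; inside; outside; ⊥)
open import Data.Fin.Subset.Properties
  using (_∈?_; s⊆s; ⊆-min; p⊆p∪q; q⊆p∪q; x∈p∪q⁻; p⊂q⇒∣p∣<∣q∣; p⊆q⇒∣p∣≤∣q∣; ∣p∣≤n; x∈⁅x⁆; x∈⁅y⁆⇒x≡y; ∣⊥∣≡0)
open import Data.Vec using (Vec; []; _∷_; lookup)
open import Data.Bool using (true)
open import Data.Bool.Properties using (_≟_)
open import Data.Product using (Σ; _×_; _,_; ∃; ∃₂)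
open import Data.Sum using (_⊎_; inj₁; inj₂)
open import Data.Empty using (⊥-elim)
open import Function.Bundles using (_⇔_; mk⇔; module Equivalence)
open import Relation.Nullary using (¬_; Dec; yes; no)
open import Relation.Nullary.Decidable using (_×-dec_; ¬?; decidable-stable)
open import Relation.Binary.PropositionalEquality using (_≡_; refl; cong)
import Relation.Binary.PropositionalEquality as ≡

open Equivalence using (to; from)

¬[A×¬B]⇔[A→B] : ∀ {A B : Set} → Dec B → (¬ (A × ¬ B)) ⇔ (A → B)
¬[A×¬B]⇔[A→B] B? = mk⇔ (λ h a → decidable-stable B? (λ ¬b → h (a , ¬b))) (λ f (a , ¬b) → ¬b (f a))

∃⊆-ofSize : ∀ {m} k (p : Subset m) → k ≤ ∣ p ∣ → ∃ λ q → q ⊆ p × ∣ q ∣ ≡ k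
∃⊆-ofSize k [] z≤n = [] , (λ ()) , refl
∃⊆-ofSize k (outside ∷ p) k≤∣p∣ with ∃⊆-ofSize k p k≤∣p∣
... | q , q⊆p , ∣q∣≡k = outside ∷ q , s⊆s q⊆p , ∣q∣≡k
∃⊆-ofSize {suc m} zero (inside ∷ p) _ = ⊥ , ⊆-min _ , ∣⊥∣≡0 (suc m)
∃⊆-ofSize (suc k) (inside ∷ p) (s≤s k≤∣p∣) with ∃⊆-ofSize k p k≤∣p∣
... | q , q⊆p , ∣q∣≡k = inside ∷ q , s⊆s q⊆p , cong suc ∣q∣≡k

m%[1+n]≡n%[1+n]⇒n≤m : ∀ m n → m % suc n ≡ n % suc n → n ≤ m
m%[1+n]≡n%[1+n]⇒n≤m m n hyp = begin
  n           ≡⟨ ≡.sym (m<n⇒m%n≡m (n<1+n n)) ⟩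
  n % suc n   ≡⟨ ≡.sym hyp ⟩
  m % suc n   ≤⟨ m%n≤m m (suc n) ⟩
  m           ∎
  where open ≤-Reasoning

module _ (G : Graph) (Z : Subset (n G)) where

  Closed : Subset (n G) → Set
  Closed R = ∀ {u w} → u ∈ R → u ∉ Z → Adj G u w → w ∉ Z → w ∈ R

  ClosedSeparation : Fin (n G) → Fin (n G) → Set
  ClosedSeparation s t = ∃ λ R → s ∈ R × t ∉ R × Closed R

  Reach-source∉ : ∀ {u v} → Reach G Z u v → u ∉ Z
  Reach-source∉ (here u∉Z)     = u∉Z
  Reach-source∉ (step u∉Z _ _) = u∉Z

  Reach-snoc : ∀ {s u w} → Reach G Z s u → Adj G u w → w ∉ Z → Reach G Z s w
  Reach-snoc (here u∉Z)      uw w∉Z = step u∉Z uw (here w∉Z)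
  Reach-snoc (step s∉Z sx r) uw w∉Z = step s∉Z sx (Reach-snoc r uw w∉Z)

  Closed-Reach : ∀ {R u v} → Closed R → u ∈ R → Reach G Z u v → v ∈ R
  Closed-Reach cl u∈R (here _)        = u∈R
  Closed-Reach cl u∈R (step u∉Z uw r) = Closed-Reach cl (cl u∈R u∉Z uw (Reach-source∉ r)) r

  LeavingEdge : Subset (n G) → Fin (n G) → Fin (n G) → Set
  LeavingEdge R u w = u ∈ R × u ∉ Z × Adj G u w × w ∉ Z × w ∉ R

  leavingEdge? : ∀ R → Dec (∃₂ (LeavingEdge R))
  leavingEdge? R = any? λ u → any? λ w →
    (u ∈? R) ×-dec ¬? (u ∈? Z) ×-dec (E G u w ≟ true) ×-dec ¬? (w ∈? Z) ×-dec ¬? (w ∈? R)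

  ¬leavingEdge⇒Closed : ∀ {R} → ¬ ∃₂ (LeavingEdge R) → Closed R
  ¬leavingEdge⇒Closed {R} none {u} {w} u∈R u∉Z uw w∉Z =
    decidable-stable (w ∈? R) (λ w∉R → none (u , w , u∈R , u∉Z , uw , w∉Z , w∉R))

  ReachableFrom : Fin (n G) → Subset (n G) → Set
  ReachableFrom s R = ∀ {v} → v ∈ R → Reach G Z s v

  reach⊎closedSeparation : ∀ {s t} m R → n G ≤ m + ∣ R ∣ → s ∈ R → ReachableFrom s R →
                           Reach G Z s t ⊎ ClosedSeparation s t
  reach⊎closedSeparation {s} {t} m R bound s∈R reach with t ∈? R | leavingEdge? R
  ... | yes t∈R | _         = inj₁ (reach t∈R)
  ... | no t∉R  | no none   = inj₂ (R , s∈R , t∉R , ¬leavingEdge⇒Closed none)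
  ... | no _    | yes (u , w , u∈R , _ , uw , w∉Z , w∉R) = extend m bound
    where
    R′ : Subset (n G)
    R′ = R ∪ ⁅ w ⁆

    ∣R∣<∣R′∣ : ∣ R ∣ < ∣ R′ ∣
    ∣R∣<∣R′∣ = p⊂q⇒∣p∣<∣q∣ (p⊆p∪q ⁅ w ⁆ , w , q⊆p∪q R ⁅ w ⁆ (x∈⁅x⁆ w) , w∉R)

    reach′ : ReachableFrom s R′
    reach′ v∈R′ with x∈p∪q⁻ R ⁅ w ⁆ v∈R′
    ... | inj₁ v∈R = reach v∈R
    ... | inj₂ v∈⁅w⁆ rewrite x∈⁅y⁆⇒x≡y w v∈⁅w⁆ = Reach-snoc (reach u∈R) uw w∉Z

    extend : ∀ m → n G ≤ m + ∣ R ∣ → Reach G Z s t ⊎ ClosedSeparation s t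
    extend zero    bound = ⊥-elim (<-irrefl refl (<-≤-trans ∣R∣<∣R′∣ (≤-trans (∣p∣≤n R′) bound)))
    extend (suc m) bound = reach⊎closedSeparation m R′ bound′ (p⊆p∪q ⁅ w ⁆ s∈R) reach′
      where
      open ≤-Reasoning
      bound′ : n G ≤ m + ∣ R′ ∣
      bound′ = begin
        n G              ≤⟨ bound ⟩
        suc m + ∣ R ∣    ≡⟨ ≡.sym (+-suc m ∣ R ∣) ⟩
        m + suc ∣ R ∣    ≤⟨ +-monoʳ-≤ m ∣R∣<∣R′∣ ⟩
        m + ∣ R′ ∣       ∎

  ¬Reach⇔ClosedSeparation : ∀ {s t} → s ∉ Z → (¬ Reach G Z s t) ⇔ ClosedSeparation s t
  ¬Reach⇔ClosedSeparation {s} {t} s∉Z = mk⇔ separate (λ (R , s∈R , t∉R , cl) r → t∉R (Closed-Reach cl s∈R r))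
    where
    reach⁅s⁆ : ReachableFrom s ⁅ s ⁆
    reach⁅s⁆ v∈⁅s⁆ rewrite x∈⁅y⁆⇒x≡y s v∈⁅s⁆ = here s∉Z

    separate : ¬ Reach G Z s t → ClosedSeparation s t
    separate ¬r with reach⊎closedSeparation (n G) ⁅ s ⁆ (m≤m+n (n G) ∣ ⁅ s ⁆ ∣) (x∈⁅x⁆ s) reach⁅s⁆
    ... | inj₁ r   = ⊥-elim (¬r r)
    ... | inj₂ sep = sep

infixr 5 _⇒′_
infix 25 _⊆′_ _⊂′_

_⇒′_ : ∀ {v S} → Formula v S → Formula v S → Formula v S
φ ⇒′ ψ = ¬′ (φ ∧′ ¬′ ψ)

_⊆′_ : ∀ {v S} → Fin S → Fin S → Formula v S
X ⊆′ Y = ∀v (mem zero X ⇒′ mem zero Y)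

_⊂′_ : ∀ {v S} → Fin S → Fin S → Formula v S
X ⊂′ Y = X ⊆′ Y ∧′ ∃v (mem zero Y ∧′ ¬′ (mem zero X))

closed′ : ∀ {v S} → Fin S → Fin S → Formula v S
closed′ Z R = ∀v (∀v ((mem u R ∧′ (¬′ (mem u Z) ∧′ (adj u w ∧′ ¬′ (mem w Z)))) ⇒′ mem w R))
  where
  u w : ∀ {v} → Fin (suc (suc v))
  u = suc zero
  w = zero

separator′ : ∀ {v S} → Fin v → Fin v → Fin S → Formula v S
separator′ a b Z = ¬′ (mem a Z) ∧′ (¬′ (mem b Z) ∧′ ∃S (mem a zero ∧′ (¬′ (mem b zero) ∧′ closed′ (suc Z) zero)))

minimalSeparator′ : ∀ {v S} → Fin v → Fin v → Fin S → Formula v S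
minimalSeparator′ a b Z = separator′ a b Z ∧′ ∀S (¬′ (zero ⊂′ suc Z ∧′ separator′ a b zero))

atLeast′ : ∀ {v S} → ℕ → Fin S → Formula v S
atLeast′ k X = ∃S (zero ⊆′ suc X ∧′ cnt k k zero)

ψ : ℕ → Formula 2 0
ψ k = ∃S (minimalSeparator′ zero (suc zero) zero ∧′ atLeast′ k zero)

length-ψ : ∀ k → length (ψ k) ≡ length (ψ 0)
length-ψ k = refl

module _ (G : Graph) {v : ℕ} (ρ : Vec (Fin (n G)) v) where

  sat-⊆′ : ∀ {S} (σ : Vec (Subset (n G)) S) X Y → Sat G ρ σ (X ⊆′ Y) ⇔ lookup σ X ⊆ lookup σ Y
  sat-⊆′ σ X Y = mk⇔
    (λ h {x} → to (¬[A×¬B]⇔[A→B] (x ∈? lookup σ Y)) (h x))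
    (λ X⊆Y x → from (¬[A×¬B]⇔[A→B] (x ∈? lookup σ Y)) X⊆Y)

  sat-⊂′ : ∀ {S} (σ : Vec (Subset (n G)) S) X Y → Sat G ρ σ (X ⊂′ Y) ⇔ lookup σ X ⊂ lookup σ Y
  sat-⊂′ σ X Y = mk⇔
    (λ (X⊆Y , witness) → to (sat-⊆′ σ X Y) X⊆Y , witness)
    (λ (X⊆Y , witness) → from (sat-⊆′ σ X Y) X⊆Y , witness)

  sat-closed′ : ∀ {S} (σ : Vec (Subset (n G)) S) Z R →
                Sat G ρ σ (closed′ Z R) ⇔ Closed G (lookup σ Z) (lookup σ R)
  sat-closed′ σ Z R = mk⇔
    (λ h {u} {w} u∈R u∉Z uw w∉Z →
      to (¬[A×¬B]⇔[A→B] (w ∈? lookup σ R)) (h u w) (u∈R , u∉Z , uw , w∉Z))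
    (λ cl u w → from (¬[A×¬B]⇔[A→B] (w ∈? lookup σ R)) (λ (u∈R , u∉Z , uw , w∉Z) → cl u∈R u∉Z uw w∉Z))

  sat-separator′ : ∀ {S} (σ : Vec (Subset (n G)) S) a b Z →
                   Sat G ρ σ (separator′ a b Z) ⇔ IsSeparator G (lookup ρ a) (lookup ρ b) (lookup σ Z)
  sat-separator′ σ a b Z = mk⇔
    (λ (a∉Z , b∉Z , R , a∈R , b∉R , cl) →
      a∉Z , b∉Z , from (closedSeparation a∉Z) (R , a∈R , b∉R , to (sat-closed′ (R ∷ σ) (suc Z) zero) cl))
    (λ (a∉Z , b∉Z , ¬r) → let (R , a∈R , b∉R , cl) = to (closedSeparation a∉Z) ¬r in
      a∉Z , b∉Z , R , a∈R , b∉R , from (sat-closed′ (R ∷ σ) (suc Z) zero) cl)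
    where
    closedSeparation : ∀ {s t} → s ∉ lookup σ Z → (¬ Reach G (lookup σ Z) s t) ⇔ ClosedSeparation G (lookup σ Z) s t
    closedSeparation = ¬Reach⇔ClosedSeparation G (lookup σ Z)

  sat-minimalSeparator′ : ∀ {S} (σ : Vec (Subset (n G)) S) a b Z →
                          Sat G ρ σ (minimalSeparator′ a b Z) ⇔ IsMinimalSeparator G (lookup ρ a) (lookup ρ b) (lookup σ Z)
  sat-minimalSeparator′ σ a b Z = mk⇔
    (λ (sep , minimal) → to (sat-separator′ σ a b Z) sep , λ Z′ Z′⊂Z sep′ →
      minimal Z′ (from (sat-⊂′ (Z′ ∷ σ) zero (suc Z)) Z′⊂Z , from (sat-separator′ (Z′ ∷ σ) a b zero) sep′))
    (λ (sep , minimal) → from (sat-separator′ σ a b Z) sep , λ Z′ (Z′⊂Z , sep′) →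
      minimal Z′ (to (sat-⊂′ (Z′ ∷ σ) zero (suc Z)) Z′⊂Z) (to (sat-separator′ (Z′ ∷ σ) a b zero) sep′))

  sat-atLeast′ : ∀ {S} (σ : Vec (Subset (n G)) S) k X → Sat G ρ σ (atLeast′ k X) ⇔ k ≤ ∣ lookup σ X ∣
  sat-atLeast′ σ k X = mk⇔
    (λ (Y , Y⊆X , ∣Y∣≡k) → ≤-trans (m%[1+n]≡n%[1+n]⇒n≤m ∣ Y ∣ k ∣Y∣≡k)
                                     (p⊆q⇒∣p∣≤∣q∣ (to (sat-⊆′ (Y ∷ σ) zero (suc X)) Y⊆X)))
    (λ k≤∣X∣ → let (Y , Y⊆X , ∣Y∣≡k) = ∃⊆-ofSize k (lookup σ X) k≤∣X∣ in
      Y , from (sat-⊆′ (Y ∷ σ) zero (suc X)) Y⊆X , cong (_% suc k) ∣Y∣≡k)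

lemma5 : Σ ℕ λ c → Σ (ℕ → Formula 2 0) λ ψ →
           (∀ k → 1 ≤ k → length (ψ k) ≤ c * k)
           × (∀ k → 1 ≤ k → (G : Graph) → (s t : Fin (n G)) → ¬ s ≡ t →
                ((G , s , t ⊨ ψ k) ⇔ HasMinSepAtLeast G s t k))
lemma5 = length (ψ 0) , ψ , length-bound , correct
  where
  length-bound : ∀ k → 1 ≤ k → length (ψ k) ≤ length (ψ 0) * k
  length-bound (suc k) _ = ≤-trans (≤-reflexive (length-ψ (suc k))) (m≤m*n (length (ψ 0)) (suc k))

  correct : ∀ k → 1 ≤ k → (G : Graph) → (s t : Fin (n G)) → ¬ s ≡ t →
            (G , s , t ⊨ ψ k) ⇔ HasMinSepAtLeast G s t k
  correct k _ G s t _ = mk⇔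
    (λ (Z , minimal , large) → Z , to (minSep Z) minimal , to (atLeast Z) large)
    (λ (Z , minimal , large) → Z , from (minSep Z) minimal , from (atLeast Z) large)
    where
    minSep : ∀ Z → Sat G (s ∷ t ∷ []) (Z ∷ []) (minimalSeparator′ zero (suc zero) zero) ⇔ IsMinimalSeparator G s t Z
    minSep Z = sat-minimalSeparator′ G (s ∷ t ∷ []) (Z ∷ []) zero (suc zero) zero

    atLeast : ∀ Z → Sat G (s ∷ t ∷ []) (Z ∷ []) (atLeast′ k zero) ⇔ k ≤ ∣ Z ∣
    atLeast Z = sat-atLeast′ G (s ∷ t ∷ []) (Z ∷ []) k zero
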